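{- Let $K$ be a number field, $\alpha\in K\setminus\{0\}$, and take $s=2$, $\alpha_1=0$, $\alpha_2=\alpha$. Then for every integer $n\ge1$, \[ A_{n,n}=\begin{pmatrix}P_{n-1,n}(0)&P_{n-1,n}(\alpha)\\ P_{n,n-1}(0)&P_{n,n-1}(\alpha)\end{pmatrix}=(n-1)!\,C_nC_{n-1}\cdots C_1, \qquad C_i=\begin{pmatrix}2i-1-\alpha&2i-1\\ 2i-1&2i-1+\alpha\end{pmatrix}\ (i\ge1). \]
   Context: For $(n_1,n_2)\in\mathbb{N}^2$ (with $\mathbb{N}=\{0,1,2,\dots\}$): $f_{n_1,n_2}(z)=z^{n_1}(z-\alpha)^{n_2}\in K[z]$, $P_{n_1,n_2}(z)=\sum_{k=0}^{n_1+n_2}f_{n_1,n_2}^{(k)}(z)$ (sum of all derivatives). For $n\ge1$, $A_{n,n}$ is the $2\times2$ matrix whose first row is $(P_{n-1,n}(0),P_{n-1,n}(\alpha))$ and whose second row is $(P_{n,n-1}(0),P_{n,n-1}(\alpha))$. -}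

module Defs where

open import Level using (Level)
open import Data.Nat using (ℕ; zero; suc; _∸_) renaming (_+_ to _ℕ+_; _*_ to _ℕ*_)
open import Data.Nat using (_!)
open import Data.Fin using (Fin; zero; suc)
open import Data.List using (List; []; _∷_)
open import Data.Empty using (⊥)
open import Relation.Binary.PropositionalEquality using (_≡_)
open import Relation.Nullary using (¬_)
open import Data.Product using (Σ; _×_)
open import Algebra.Bundles using (CommutativeRing)

-- Everything is relative to a commutative ring R (the field K of the paper).
module Poly {c ℓ : Level} (R : CommutativeRing c ℓ) where
  open CommutativeRing R hiding (zero)
  open import Algebra.Properties.Monoid.Mult +-monoid using () renaming (_×_ to _·_)

  IsFieldR : Set (c Level.⊔ ℓ)
  IsFieldR = (¬ (1# ≈ 0#)) × ((x : Carrier) → ¬ (x ≈ 0#) → Σ Carrier (λ y → x * y ≈ 1#))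

  CharZero : Set ℓ
  CharZero = (n : ℕ) → n · 1# ≈ 0# → n ≡ 0

  -- Polynomials in K[z] as coefficient lists, lowest degree first.
  Pol : Set c
  Pol = List Carrier

  addP : Pol → Pol → Pol
  addP []       q        = q
  addP (a ∷ p)  []       = a ∷ p
  addP (a ∷ p)  (b ∷ q)  = (a + b) ∷ addP p q

  scaleP : Carrier → Pol → Pol
  scaleP a []      = []
  scaleP a (b ∷ p) = (a * b) ∷ scaleP a p

  mulP : Pol → Pol → Pol
  mulP []      q = []
  mulP (a ∷ p) q = addP (scaleP a q) (0# ∷ mulP p q)

  oneP : Pol
  oneP = 1# ∷ []

  zP : Pol
  zP = 0# ∷ 1# ∷ []

  linP : Carrier → Pol
  linP a = (- a) ∷ 1# ∷ []

  powP : Pol → ℕ → Pol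
  powP p zero    = oneP
  powP p (suc n) = mulP p (powP p n)

  derivAux : ℕ → Pol → Pol
  derivAux k []      = []
  derivAux k (a ∷ p) = (k · a) ∷ derivAux (suc k) p

  deriv : Pol → Pol
  deriv []      = []
  deriv (a ∷ p) = derivAux 1 p

  derivN : ℕ → Pol → Pol
  derivN zero    p = p
  derivN (suc k) p = deriv (derivN k p)

  eval : Pol → Carrier → Carrier
  eval []      x = 0#
  eval (a ∷ p) x = a + x * eval p x

  f : Carrier → ℕ → ℕ → Pol
  f α n₁ n₂ = mulP (powP zP n₁) (powP (linP α) n₂)

  sumDerivs : ℕ → Pol → Pol
  sumDerivs zero    p = derivN 0 p
  sumDerivs (suc m) p = addP (sumDerivs m p) (derivN (suc m) p)

  P : Carrier → ℕ → ℕ → Pol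
  P α n₁ n₂ = sumDerivs (n₁ ℕ+ n₂) (f α n₁ n₂)

  Mat2 : Set c
  Mat2 = Fin 2 → Fin 2 → Carrier

  _≈M_ : Mat2 → Mat2 → Set ℓ
  A ≈M B = (i j : Fin 2) → A i j ≈ B i j

  mat : Carrier → Carrier → Carrier → Carrier → Mat2
  mat a b c' d zero    zero    = a
  mat a b c' d zero    (suc _) = b
  mat a b c' d (suc _) zero    = c'
  mat a b c' d (suc _) (suc _) = d

  infixl 7 _*M_
  _*M_ : Mat2 → Mat2 → Mat2
  (A *M B) i j = A i zero * B zero j + A i (suc zero) * B (suc zero) j

  idM : Mat2
  idM = mat 1# 0# 0# 1#

  infixr 6 _·M_
  _·M_ : ℕ → Mat2 → Mat2
  (k ·M A) i j = k · A i j

  A : Carrier → ℕ → Mat2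
  A α n = mat (eval (P α (n ∸ 1) n) 0#) (eval (P α (n ∸ 1) n) α)
              (eval (P α n (n ∸ 1)) 0#) (eval (P α n (n ∸ 1)) α)

  -- C_i = [[2i-1-α, 2i-1], [2i-1, 2i-1+α]] (for i ≥ 1; 2i-1 computed in ℕ then mapped into K)
  C : Carrier → ℕ → Mat2
  C α i = mat (t - α) t t (t + α)
    where t = ((2 ℕ* i) ∸ 1) · 1#

  prodC : Carrier → ℕ → Mat2
  prodC α zero    = idM
  prodC α (suc i) = C α (suc i) *M prodC α i

{-# OPTIONS --safe #-}
module Submission where

-- Since f_{a,b}^{(a+b+1)} = 0, P_{a,b} = f_{a,b} + Σ_k (f′_{a,b})^{(k)}, and f′_{a+1,b+1} = (a+1) f_{a,b+1} + (b+1) f_{a+1,b}.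
-- At the common roots x ∈ {0, α} of the f_{a+1,b+1} this gives
--   P_{a+1,b+1}(x) = (a+1) P_{a,b+1}(x) + (b+1) P_{a+1,b}(x),
-- while writing z = (z − α) + α, resp. z − α = z + (−α), in one factor of f_{a+1,b+1} gives the polynomial identities
--   P_{a+1,b+1} = P_{a,b+2} + α P_{a,b+1} = P_{a+2,b} − α P_{a+1,b}.
-- Eliminating P_{m+1,m+1}, P_{m,m+2} and P_{m+2,m} turns these into the column recurrence
-- A_{m+2,m+2} = (m+1) C_{m+2} A_{m+1,m+1}; with A_{1,1} = C_1 the factors m+1 accumulate to (n−1)!.

open import Defs
open import Level using (Level)
open import Data.Nat using (ℕ; zero; suc; _∸_; _≤_; _≥_; _!)
import Data.Nat as ℕ
import Data.Nat.Properties as ℕ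
open import Data.Fin using (zero; suc)
open import Data.List using ([]; _∷_)
open import Data.Product using (_×_; _,_; proj₁; proj₂)
open import Relation.Nullary using (¬_)
import Relation.Binary.PropositionalEquality as ≡
open import Relation.Binary.Bundles using (Setoid)
open import Algebra.Bundles using (CommutativeRing; CommutativeMonoid)
open import Algebra.Structures.Biased using (isCommutativeMonoidˡ)
import Algebra.Properties.CommutativeSemigroup as CommutativeSemigroupProperties
import Algebra.Solver.Ring.NaturalCoefficients.Default as NaturalCoefficientsSolver
import Relation.Binary.Reasoning.Setoid as SetoidReasoning

module Polynomials {c ℓ : Level} (R : CommutativeRing c ℓ) where
  open Poly R
  open CommutativeRing R hiding (zero)
  open import Algebra.Properties.Semiring.Mult semiring
    using (×-congʳ; ×-congˡ; ×-comm-*) renaming (_×_ to _·_)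
  open import Algebra.Properties.CommutativeMonoid.Mult +-commutativeMonoid using (×-distrib-+)

  ×-zeroʳ : ∀ n → n · 0# ≈ 0#
  ×-zeroʳ zero    = refl
  ×-zeroʳ (suc n) = trans (+-identityˡ _) (×-zeroʳ n)

  coeff : Pol → ℕ → Carrier
  coeff []      _       = 0#
  coeff (a ∷ p) zero    = a
  coeff (a ∷ p) (suc k) = coeff p k

  -- Coefficient lists are compared up to trailing zeros.
  infix 4 _≋_
  record _≋_ (p q : Pol) : Set ℓ where
    constructor coeffwise
    field coeff-≈ : ∀ k → coeff p k ≈ coeff q k
  open _≋_ public

  ≋-setoid : Setoid c ℓ
  ≋-setoid = record
    { Carrier       = Pol
    ; _≈_           = _≋_
    ; isEquivalence = record
      { refl  = coeffwise λ _ → refl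
      ; sym   = λ p≋q → coeffwise λ k → sym (coeff-≈ p≋q k)
      ; trans = λ p≋q q≋r → coeffwise λ k → trans (coeff-≈ p≋q k) (coeff-≈ q≋r k)
      }
    }

  open Setoid ≋-setoid public
    using () renaming (refl to ≋-refl; sym to ≋-sym; trans to ≋-trans; reflexive to ≋-reflexive)

  ∷-cong : ∀ {a b p q} → a ≈ b → p ≋ q → (a ∷ p) ≋ (b ∷ q)
  ∷-cong a≈b p≋q = coeffwise λ { zero → a≈b ; (suc k) → coeff-≈ p≋q k }

  ∷-injectiveʳ : ∀ {a b p q} → (a ∷ p) ≋ (b ∷ q) → p ≋ q
  ∷-injectiveʳ h = coeffwise λ k → coeff-≈ h (suc k)

  ∷≋[] : ∀ {a p} → a ≈ 0# → p ≋ [] → (a ∷ p) ≋ []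
  ∷≋[] a≈0 p≋[] = coeffwise λ { zero → a≈0 ; (suc k) → coeff-≈ p≋[] k }

  ∷≋[]⇒tail≋[] : ∀ {a p} → (a ∷ p) ≋ [] → p ≋ []
  ∷≋[]⇒tail≋[] h = coeffwise λ k → coeff-≈ h (suc k)

  coeff-addP : ∀ p q k → coeff (addP p q) k ≈ coeff p k + coeff q k
  coeff-addP []      q       k       = sym (+-identityˡ _)
  coeff-addP (a ∷ p) []      k       = sym (+-identityʳ _)
  coeff-addP (a ∷ p) (b ∷ q) zero    = refl
  coeff-addP (a ∷ p) (b ∷ q) (suc k) = coeff-addP p q k

  coeff-scaleP : ∀ a p k → coeff (scaleP a p) k ≈ a * coeff p k
  coeff-scaleP a []      k       = sym (zeroʳ a)
  coeff-scaleP a (b ∷ p) zero    = refl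
  coeff-scaleP a (b ∷ p) (suc k) = coeff-scaleP a p k

  addP-cong : ∀ {p p′ q q′} → p ≋ p′ → q ≋ q′ → addP p q ≋ addP p′ q′
  addP-cong {p} {p′} {q} {q′} p≋p′ q≋q′ = coeffwise λ k → begin
    coeff (addP p q) k     ≈⟨ coeff-addP p q k ⟩
    coeff p k + coeff q k   ≈⟨ +-cong (coeff-≈ p≋p′ k) (coeff-≈ q≋q′ k) ⟩
    coeff p′ k + coeff q′ k ≈⟨ coeff-addP p′ q′ k ⟨
    coeff (addP p′ q′) k   ∎
    where open SetoidReasoning setoid

  addP-congˡ : ∀ p {q q′} → q ≋ q′ → addP p q ≋ addP p q′
  addP-congˡ p = addP-cong ≋-refl

  addP-congʳ : ∀ q {p p′} → p ≋ p′ → addP p q ≋ addP p′ q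
  addP-congʳ q p≋p′ = addP-cong p≋p′ ≋-refl

  addP-assoc : ∀ p q r → addP (addP p q) r ≋ addP p (addP q r)
  addP-assoc p q r = coeffwise λ k → begin
    coeff (addP (addP p q) r) k          ≈⟨ trans (coeff-addP (addP p q) r k) (+-congʳ (coeff-addP p q k)) ⟩
    (coeff p k + coeff q k) + coeff r k  ≈⟨ +-assoc _ _ _ ⟩
    coeff p k + (coeff q k + coeff r k)  ≈⟨ trans (coeff-addP p (addP q r) k) (+-congˡ (coeff-addP q r k)) ⟨
    coeff (addP p (addP q r)) k          ∎
    where open SetoidReasoning setoid

  addP-comm : ∀ p q → addP p q ≋ addP q p
  addP-comm p q = coeffwise λ k →
    trans (coeff-addP p q k) (trans (+-comm _ _) (sym (coeff-addP q p k)))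

  addP-commutativeMonoid : CommutativeMonoid c ℓ
  addP-commutativeMonoid = record
    { isCommutativeMonoid = isCommutativeMonoidˡ record
      { isSemigroup = record
        { isMagma = record { isEquivalence = Setoid.isEquivalence ≋-setoid ; ∙-cong = addP-cong }
        ; assoc   = addP-assoc
        }
      ; identityˡ = λ _ → ≋-refl
      ; comm      = addP-comm
      }
    }

  open CommutativeSemigroupProperties (CommutativeMonoid.commutativeSemigroup addP-commutativeMonoid)
    public using () renaming (interchange to addP-interchange; x∙yz≈y∙xz to addP-swap)
  open CommutativeMonoid addP-commutativeMonoid
    public using () renaming (identityʳ to addP-identityʳ)

  0∷-addP : ∀ p q → (0# ∷ addP p q) ≋ addP (0# ∷ p) (0# ∷ q)
  0∷-addP p q = ∷-cong (sym (+-identityʳ 0#)) ≋-refl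

  scaleP-cong : ∀ {a b p q} → a ≈ b → p ≋ q → scaleP a p ≋ scaleP b q
  scaleP-cong {a} {b} {p} {q} a≈b p≋q = coeffwise λ k →
    trans (coeff-scaleP a p k) (trans (*-cong a≈b (coeff-≈ p≋q k)) (sym (coeff-scaleP b q k)))

  coeff-addP-scaleP : ∀ a p b q k → coeff (addP (scaleP a p) (scaleP b q)) k ≈ a * coeff p k + b * coeff q k
  coeff-addP-scaleP a p b q k =
    trans (coeff-addP (scaleP a p) (scaleP b q) k) (+-cong (coeff-scaleP a p k) (coeff-scaleP b q k))

  scaleP-distribˡ : ∀ a p q → scaleP a (addP p q) ≋ addP (scaleP a p) (scaleP a q)
  scaleP-distribˡ a p q = coeffwise λ k → begin
    coeff (scaleP a (addP p q)) k                ≈⟨ trans (coeff-scaleP a (addP p q) k) (*-congˡ (coeff-addP p q k)) ⟩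
    a * (coeff p k + coeff q k)                  ≈⟨ distribˡ a _ _ ⟩
    a * coeff p k + a * coeff q k                ≈⟨ coeff-addP-scaleP a p a q k ⟨
    coeff (addP (scaleP a p) (scaleP a q)) k     ∎
    where open SetoidReasoning setoid

  scaleP-distribʳ : ∀ a b p → scaleP (a + b) p ≋ addP (scaleP a p) (scaleP b p)
  scaleP-distribʳ a b p = coeffwise λ k → begin
    coeff (scaleP (a + b) p) k                   ≈⟨ coeff-scaleP (a + b) p k ⟩
    (a + b) * coeff p k                          ≈⟨ distribʳ _ a b ⟩
    a * coeff p k + b * coeff p k                ≈⟨ coeff-addP-scaleP a p b p k ⟨
    coeff (addP (scaleP a p) (scaleP b p)) k     ∎
    where open SetoidReasoning setoid

  scaleP-assoc : ∀ a b p → scaleP a (scaleP b p) ≋ scaleP (a * b) p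
  scaleP-assoc a b p = coeffwise λ k →
    trans (coeff-scaleP a (scaleP b p) k) (trans (*-congˡ (coeff-scaleP b p k))
      (trans (sym (*-assoc _ _ _)) (sym (coeff-scaleP (a * b) p k))))

  scaleP-identityˡ : ∀ p → scaleP 1# p ≋ p
  scaleP-identityˡ p = coeffwise λ k → trans (coeff-scaleP 1# p k) (*-identityˡ _)

  scaleP-zeroˡ : ∀ {a} p → a ≈ 0# → scaleP a p ≋ []
  scaleP-zeroˡ {a} p a≈0 = coeffwise λ k → trans (coeff-scaleP a p k) (trans (*-congʳ a≈0) (zeroˡ _))

  scaleP-zeroʳ : ∀ a {p} → p ≋ [] → scaleP a p ≋ []
  scaleP-zeroʳ a {p} p≋[] = coeffwise λ k → trans (coeff-scaleP a p k) (trans (*-congˡ (coeff-≈ p≋[] k)) (zeroʳ a))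

  mulP-zeroʳ : ∀ p → mulP p [] ≋ []
  mulP-zeroʳ []      = ≋-refl
  mulP-zeroʳ (a ∷ p) = ∷≋[] refl (mulP-zeroʳ p)

  mulP-≋[]ˡ : ∀ {p} q → p ≋ [] → mulP p q ≋ []
  mulP-≋[]ˡ {[]}    q p≋[] = ≋-refl
  mulP-≋[]ˡ {a ∷ p} q p≋[] =
    addP-cong (scaleP-zeroˡ q (coeff-≈ p≋[] 0)) (∷≋[] refl (mulP-≋[]ˡ q (∷≋[]⇒tail≋[] p≋[])))

  mulP-congˡ : ∀ {p p′} q → p ≋ p′ → mulP p q ≋ mulP p′ q
  mulP-congˡ {[]}    {[]}     q p≋p′ = ≋-refl
  mulP-congˡ {[]}    {b ∷ p′} q p≋p′ = ≋-sym (mulP-≋[]ˡ q (≋-sym p≋p′))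
  mulP-congˡ {a ∷ p} {[]}     q p≋p′ = mulP-≋[]ˡ q p≋p′
  mulP-congˡ {a ∷ p} {b ∷ p′} q p≋p′ =
    addP-cong (scaleP-cong (coeff-≈ p≋p′ 0) ≋-refl) (∷-cong refl (mulP-congˡ q (∷-injectiveʳ p≋p′)))

  mulP-congʳ : ∀ p {q q′} → q ≋ q′ → mulP p q ≋ mulP p q′
  mulP-congʳ []      q≋q′ = ≋-refl
  mulP-congʳ (a ∷ p) q≋q′ = addP-cong (scaleP-cong refl q≋q′) (∷-cong refl (mulP-congʳ p q≋q′))

  mulP-cong : ∀ {p p′ q q′} → p ≋ p′ → q ≋ q′ → mulP p q ≋ mulP p′ q′
  mulP-cong {p′ = p′} {q = q} p≋p′ q≋q′ = ≋-trans (mulP-congˡ q p≋p′) (mulP-congʳ p′ q≋q′)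

  mulP-shiftˡ : ∀ p q → mulP (0# ∷ p) q ≋ (0# ∷ mulP p q)
  mulP-shiftˡ p q = addP-cong (scaleP-zeroˡ q refl) ≋-refl

  mulP-distribʳ : ∀ p q r → mulP (addP p q) r ≋ addP (mulP p r) (mulP q r)
  mulP-distribʳ []      q       r = ≋-refl
  mulP-distribʳ (a ∷ p) []      r = ≋-sym (addP-identityʳ _)
  mulP-distribʳ (a ∷ p) (b ∷ q) r = begin
    addP (scaleP (a + b) r) (0# ∷ mulP (addP p q) r)
      ≈⟨ addP-cong (scaleP-distribʳ a b r) (≋-trans (∷-cong refl (mulP-distribʳ p q r)) (0∷-addP (mulP p r) (mulP q r))) ⟩
    addP (addP (scaleP a r) (scaleP b r)) (addP (0# ∷ mulP p r) (0# ∷ mulP q r))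
      ≈⟨ addP-interchange (scaleP a r) (scaleP b r) (0# ∷ mulP p r) (0# ∷ mulP q r) ⟩
    addP (mulP (a ∷ p) r) (mulP (b ∷ q) r) ∎
    where open SetoidReasoning ≋-setoid

  mulP-scaleˡ : ∀ a p q → mulP (scaleP a p) q ≋ scaleP a (mulP p q)
  mulP-scaleˡ a []      q = ≋-refl
  mulP-scaleˡ a (b ∷ p) q = begin
    addP (scaleP (a * b) q) (0# ∷ mulP (scaleP a p) q)
      ≈⟨ addP-cong (≋-sym (scaleP-assoc a b q)) (∷-cong (sym (zeroʳ a)) (mulP-scaleˡ a p q)) ⟩
    addP (scaleP a (scaleP b q)) (scaleP a (0# ∷ mulP p q))
      ≈⟨ scaleP-distribˡ a (scaleP b q) (0# ∷ mulP p q) ⟨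
    scaleP a (mulP (b ∷ p) q) ∎
    where open SetoidReasoning ≋-setoid

  mulP-consʳ : ∀ p b q → mulP p (b ∷ q) ≋ addP (scaleP b p) (0# ∷ mulP p q)
  mulP-consʳ []      b q = ≋-sym (∷≋[] refl ≋-refl)
  mulP-consʳ (a ∷ p) b q = ∷-cong (+-congʳ (*-comm a b)) (begin
    addP (scaleP a q) (mulP p (b ∷ q))
      ≈⟨ addP-cong ≋-refl (mulP-consʳ p b q) ⟩
    addP (scaleP a q) (addP (scaleP b p) (0# ∷ mulP p q))
      ≈⟨ addP-swap (scaleP a q) (scaleP b p) (0# ∷ mulP p q) ⟩
    addP (scaleP b p) (addP (scaleP a q) (0# ∷ mulP p q)) ∎)
    where
    open SetoidReasoning ≋-setoid

  mulP-comm : ∀ p q → mulP p q ≋ mulP q p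
  mulP-comm []      q = ≋-sym (mulP-zeroʳ q)
  mulP-comm (a ∷ p) q =
    ≋-trans (addP-cong ≋-refl (∷-cong refl (mulP-comm p q))) (≋-sym (mulP-consʳ q a p))

  mulP-assoc : ∀ p q r → mulP (mulP p q) r ≋ mulP p (mulP q r)
  mulP-assoc []      q r = ≋-refl
  mulP-assoc (a ∷ p) q r = ≋-trans (mulP-distribʳ (scaleP a q) (0# ∷ mulP p q) r)
    (addP-cong (mulP-scaleˡ a q r) (≋-trans (mulP-shiftˡ (mulP p q) r) (∷-cong refl (mulP-assoc p q r))))

  mulP-scaleʳ : ∀ a p q → mulP p (scaleP a q) ≋ scaleP a (mulP p q)
  mulP-scaleʳ a p q =
    ≋-trans (mulP-comm p (scaleP a q)) (≋-trans (mulP-scaleˡ a q p) (scaleP-cong refl (mulP-comm q p)))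

  mulP-constˡ : ∀ a p → mulP (a ∷ []) p ≋ scaleP a p
  mulP-constˡ a p = ≋-trans (addP-cong ≋-refl (∷≋[] refl ≋-refl)) (addP-identityʳ (scaleP a p))

  mulP-addP-const : ∀ p c r → mulP (addP p (c ∷ [])) r ≋ addP (mulP p r) (scaleP c r)
  mulP-addP-const p c r = ≋-trans (mulP-distribʳ p (c ∷ []) r) (addP-congˡ (mulP p r) (mulP-constˡ c r))

  mulP-identityˡ : ∀ p → mulP oneP p ≋ p
  mulP-identityˡ p = ≋-trans (mulP-constˡ 1# p) (scaleP-identityˡ p)

  mulP-commutativeMonoid : CommutativeMonoid c ℓ
  mulP-commutativeMonoid = record
    { _∙_                 = mulP
    ; ε                   = oneP
    ; isCommutativeMonoid = isCommutativeMonoidˡ record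
      { isSemigroup = record
        { isMagma = record { isEquivalence = Setoid.isEquivalence ≋-setoid ; ∙-cong = mulP-cong }
        ; assoc   = mulP-assoc
        }
      ; identityˡ = mulP-identityˡ
      ; comm      = mulP-comm
      }
    }

  open CommutativeSemigroupProperties (CommutativeMonoid.commutativeSemigroup mulP-commutativeMonoid)
    public using () renaming (x∙yz≈y∙xz to mulP-swap)
  open CommutativeMonoid mulP-commutativeMonoid
    public using () renaming (identityʳ to mulP-identityʳ)

  coeff-derivAux : ∀ j p k → coeff (derivAux j p) k ≈ (j ℕ.+ k) · coeff p k
  coeff-derivAux j []      k       = sym (×-zeroʳ (j ℕ.+ k))
  coeff-derivAux j (a ∷ p) zero    = ×-congˡ (≡.sym (ℕ.+-identityʳ j))
  coeff-derivAux j (a ∷ p) (suc k) =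
    trans (coeff-derivAux (suc j) p k) (×-congˡ (≡.sym (ℕ.+-suc j k)))

  coeff-deriv : ∀ p k → coeff (deriv p) k ≈ suc k · coeff p (suc k)
  coeff-deriv []      k = sym (×-zeroʳ (suc k))
  coeff-deriv (a ∷ p) k = coeff-derivAux 1 p k

  deriv-cong : ∀ {p q} → p ≋ q → deriv p ≋ deriv q
  deriv-cong {p} {q} p≋q = coeffwise λ k →
    trans (coeff-deriv p k) (trans (×-congʳ (suc k) (coeff-≈ p≋q (suc k))) (sym (coeff-deriv q k)))

  deriv-addP : ∀ p q → deriv (addP p q) ≋ addP (deriv p) (deriv q)
  deriv-addP p q = coeffwise λ k → begin
    coeff (deriv (addP p q)) k                      ≈⟨ coeff-deriv (addP p q) k ⟩
    suc k · coeff (addP p q) (suc k)                ≈⟨ ×-congʳ (suc k) (coeff-addP p q (suc k)) ⟩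
    suc k · (coeff p (suc k) + coeff q (suc k))     ≈⟨ ×-distrib-+ _ _ (suc k) ⟩
    suc k · coeff p (suc k) + suc k · coeff q (suc k) ≈⟨ +-cong (coeff-deriv p k) (coeff-deriv q k) ⟨
    coeff (deriv p) k + coeff (deriv q) k           ≈⟨ coeff-addP (deriv p) (deriv q) k ⟨
    coeff (addP (deriv p) (deriv q)) k              ∎
    where open SetoidReasoning setoid

  deriv-scaleP : ∀ a p → deriv (scaleP a p) ≋ scaleP a (deriv p)
  deriv-scaleP a p = coeffwise λ k → begin
    coeff (deriv (scaleP a p)) k        ≈⟨ coeff-deriv (scaleP a p) k ⟩
    suc k · coeff (scaleP a p) (suc k)  ≈⟨ ×-congʳ (suc k) (coeff-scaleP a p (suc k)) ⟩
    suc k · (a * coeff p (suc k))       ≈⟨ ×-comm-* (suc k) a _ ⟨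
    a * (suc k · coeff p (suc k))       ≈⟨ *-congˡ (coeff-deriv p k) ⟨
    a * coeff (deriv p) k               ≈⟨ coeff-scaleP a (deriv p) k ⟨
    coeff (scaleP a (deriv p)) k        ∎
    where open SetoidReasoning setoid

  -- a ∷ p encodes a + z p, so this is (a + z p)′ = p + z p′.
  deriv-∷ : ∀ a p → deriv (a ∷ p) ≋ addP p (0# ∷ deriv p)
  deriv-∷ a p = coeffwise λ where
    zero    → trans (coeff-deriv (a ∷ p) 0) (sym (coeff-addP p (0# ∷ deriv p) 0))
    (suc k) → trans (coeff-deriv (a ∷ p) (suc k))
                (trans (+-congˡ (sym (coeff-deriv p k))) (sym (coeff-addP p (0# ∷ deriv p) (suc k))))

  leibniz : ∀ p q → deriv (mulP p q) ≋ addP (mulP (deriv p) q) (mulP p (deriv q))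
  leibniz []      q = ≋-refl
  leibniz (a ∷ p) q = begin
    deriv (addP (scaleP a q) (0# ∷ mulP p q))
      ≈⟨ ≋-trans (deriv-addP (scaleP a q) (0# ∷ mulP p q)) (addP-cong (deriv-scaleP a q) (deriv-∷ 0# (mulP p q))) ⟩
    addP (scaleP a q′) (addP (mulP p q) (0# ∷ deriv (mulP p q)))
      ≈⟨ addP-congˡ (scaleP a q′) (addP-congˡ (mulP p q) (∷-cong refl (leibniz p q))) ⟩
    addP (scaleP a q′) (addP (mulP p q) (0# ∷ addP (mulP p′ q) (mulP p q′)))
      ≈⟨ addP-congˡ (scaleP a q′) (addP-congˡ (mulP p q) (0∷-addP (mulP p′ q) (mulP p q′))) ⟩
    addP (scaleP a q′) (addP (mulP p q) (addP (0# ∷ mulP p′ q) (0# ∷ mulP p q′)))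
      ≈⟨ addP-congˡ (scaleP a q′) (≋-sym (addP-assoc (mulP p q) (0# ∷ mulP p′ q) (0# ∷ mulP p q′))) ⟩
    addP (scaleP a q′) (addP (addP (mulP p q) (0# ∷ mulP p′ q)) (0# ∷ mulP p q′))
      ≈⟨ addP-swap (scaleP a q′) (addP (mulP p q) (0# ∷ mulP p′ q)) (0# ∷ mulP p q′) ⟩
    addP (addP (mulP p q) (0# ∷ mulP p′ q)) (mulP (a ∷ p) q′)
      ≈⟨ addP-congʳ (mulP (a ∷ p) q′) (addP-congˡ (mulP p q) (mulP-shiftˡ p′ q)) ⟨
    addP (addP (mulP p q) (mulP (0# ∷ p′) q)) (mulP (a ∷ p) q′)
      ≈⟨ addP-congʳ (mulP (a ∷ p) q′) (mulP-distribʳ p (0# ∷ p′) q) ⟨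
    addP (mulP (addP p (0# ∷ p′)) q) (mulP (a ∷ p) q′)
      ≈⟨ addP-congʳ (mulP (a ∷ p) q′) (mulP-congˡ q (deriv-∷ a p)) ⟨
    addP (mulP (deriv (a ∷ p)) q) (mulP (a ∷ p) q′) ∎
    where
    p′ = deriv p
    q′ = deriv q
    open SetoidReasoning ≋-setoid

  deriv-powP : ∀ {p} → deriv p ≋ oneP → ∀ n → deriv (powP p n) ≋ scaleP (n · 1#) (powP p (n ∸ 1))
  deriv-powP p′≋1 zero = ≋-sym (scaleP-zeroˡ oneP refl)
  deriv-powP {p} p′≋1 (suc zero) = begin
    deriv (mulP p oneP)                       ≈⟨ leibniz p oneP ⟩
    addP (mulP (deriv p) oneP) (mulP p [])    ≈⟨ addP-cong (≋-trans (mulP-identityʳ (deriv p)) p′≋1) (mulP-zeroʳ p) ⟩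
    addP oneP []                              ≈⟨ addP-identityʳ oneP ⟩
    oneP                                      ≈⟨ ≋-trans (scaleP-cong (+-identityʳ 1#) ≋-refl) (scaleP-identityˡ oneP) ⟨
    scaleP (1 · 1#) oneP                      ∎
    where open SetoidReasoning ≋-setoid
  deriv-powP {p} p′≋1 (suc n@(suc m)) = begin
    deriv (mulP p pⁿ)                                  ≈⟨ leibniz p pⁿ ⟩
    addP (mulP (deriv p) pⁿ) (mulP p (deriv pⁿ))       ≈⟨ addP-cong (≋-trans (mulP-congˡ pⁿ p′≋1) (mulP-identityˡ pⁿ))
                                                                    (mulP-congʳ p (deriv-powP p′≋1 n)) ⟩
    addP pⁿ (mulP p (scaleP (n · 1#) (powP p m)))      ≈⟨ addP-congˡ pⁿ (mulP-scaleʳ (n · 1#) p (powP p m)) ⟩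
    addP pⁿ (scaleP (n · 1#) pⁿ)                       ≈⟨ addP-congʳ (scaleP (n · 1#) pⁿ) (scaleP-identityˡ pⁿ) ⟨
    addP (scaleP 1# pⁿ) (scaleP (n · 1#) pⁿ)           ≈⟨ scaleP-distribʳ 1# (n · 1#) pⁿ ⟨
    scaleP (suc n · 1#) pⁿ                             ∎
    where
    pⁿ = powP p n
    open SetoidReasoning ≋-setoid

  derivN-suc : ∀ k p → derivN (suc k) p ≡.≡ derivN k (deriv p)
  derivN-suc zero    p = ≡.refl
  derivN-suc (suc k) p = ≡.cong deriv (derivN-suc k p)

  derivN-cong : ∀ k {p q} → p ≋ q → derivN k p ≋ derivN k q
  derivN-cong zero    p≋q = p≋q
  derivN-cong (suc k) p≋q = deriv-cong (derivN-cong k p≋q)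

  derivN-addP : ∀ k p q → derivN k (addP p q) ≋ addP (derivN k p) (derivN k q)
  derivN-addP zero    p q = ≋-refl
  derivN-addP (suc k) p q = ≋-trans (deriv-cong (derivN-addP k p q)) (deriv-addP (derivN k p) (derivN k q))

  derivN-scaleP : ∀ k a p → derivN k (scaleP a p) ≋ scaleP a (derivN k p)
  derivN-scaleP zero    a p = ≋-refl
  derivN-scaleP (suc k) a p = ≋-trans (deriv-cong (derivN-scaleP k a p)) (deriv-scaleP a (derivN k p))

  derivN-≋[]-mono : ∀ {n p} → derivN (suc n) p ≋ [] → ∀ k → derivN (suc (k ℕ.+ n)) p ≋ []
  derivN-≋[]-mono vanishes zero    = vanishes
  derivN-≋[]-mono vanishes (suc k) = deriv-cong (derivN-≋[]-mono vanishes k)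

  sumDerivs-cong : ∀ m {p q} → p ≋ q → sumDerivs m p ≋ sumDerivs m q
  sumDerivs-cong zero    p≋q = p≋q
  sumDerivs-cong (suc m) p≋q = addP-cong (sumDerivs-cong m p≋q) (derivN-cong (suc m) p≋q)

  sumDerivs-addP : ∀ m p q → sumDerivs m (addP p q) ≋ addP (sumDerivs m p) (sumDerivs m q)
  sumDerivs-addP zero    p q = ≋-refl
  sumDerivs-addP (suc m) p q =
    ≋-trans (addP-cong (sumDerivs-addP m p q) (derivN-addP (suc m) p q))
            (addP-interchange (sumDerivs m p) (sumDerivs m q) (derivN (suc m) p) (derivN (suc m) q))

  sumDerivs-scaleP : ∀ m a p → sumDerivs m (scaleP a p) ≋ scaleP a (sumDerivs m p)
  sumDerivs-scaleP zero    a p = ≋-refl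
  sumDerivs-scaleP (suc m) a p =
    ≋-trans (addP-cong (sumDerivs-scaleP m a p) (derivN-scaleP (suc m) a p))
            (≋-sym (scaleP-distribˡ a (sumDerivs m p) (derivN (suc m) p)))

  sumDerivs-addP-scaleP : ∀ m p c q → sumDerivs m (addP p (scaleP c q)) ≋ addP (sumDerivs m p) (scaleP c (sumDerivs m q))
  sumDerivs-addP-scaleP m p c q =
    ≋-trans (sumDerivs-addP m p (scaleP c q)) (addP-congˡ (sumDerivs m p) (sumDerivs-scaleP m c q))

  sumDerivs-suc : ∀ m p → sumDerivs (suc m) p ≋ addP p (sumDerivs m (deriv p))
  sumDerivs-suc zero    p = ≋-refl
  sumDerivs-suc (suc m) p = begin
    addP (sumDerivs (suc m) p) (derivN (suc (suc m)) p)            ≈⟨ addP-congʳ (derivN (suc (suc m)) p) (sumDerivs-suc m p) ⟩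
    addP (addP p (sumDerivs m (deriv p))) (derivN (suc (suc m)) p) ≈⟨ addP-assoc p (sumDerivs m (deriv p)) (derivN (suc (suc m)) p) ⟩
    addP p (addP (sumDerivs m (deriv p)) (derivN (suc (suc m)) p))
      ≡⟨ ≡.cong (λ q → addP p (addP (sumDerivs m (deriv p)) q)) (derivN-suc (suc m) p) ⟩
    addP p (sumDerivs (suc m) (deriv p))                           ∎
    where open SetoidReasoning ≋-setoid

  sumDerivs-stable : ∀ {n m} p → derivN (suc n) p ≋ [] → n ≤ m → sumDerivs m p ≋ sumDerivs n p
  sumDerivs-stable {n} p vanishes n≤m with ℕ.m≤n⇒∃[o]m+o≡n n≤m
  ... | k , ≡.refl = ≋-trans (≋-reflexive (≡.cong (λ m → sumDerivs m p) (ℕ.+-comm n k))) (extend k)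
    where
    extend : ∀ k → sumDerivs (k ℕ.+ n) p ≋ sumDerivs n p
    extend zero    = ≋-refl
    extend (suc k) = ≋-trans (addP-cong (extend k) (derivN-≋[]-mono vanishes k)) (addP-identityʳ (sumDerivs n p))

  module _ (x : Carrier) where
    open NaturalCoefficientsSolver commutativeSemiring using (solve; _:=_; _:+_; _:*_)

    eval-≋[] : ∀ {p} → p ≋ [] → eval p x ≈ 0#
    eval-≋[] {[]}    _    = refl
    eval-≋[] {a ∷ p} p≋[] =
      trans (+-cong (coeff-≈ p≋[] 0) (trans (*-congˡ (eval-≋[] (∷≋[]⇒tail≋[] p≋[]))) (zeroʳ x))) (+-identityʳ 0#)

    eval-cong : ∀ {p q} → p ≋ q → eval p x ≈ eval q x
    eval-cong {[]}    {q}     p≋q = sym (eval-≋[] (≋-sym p≋q))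
    eval-cong {a ∷ p} {[]}    p≋q = eval-≋[] p≋q
    eval-cong {a ∷ p} {b ∷ q} p≋q = +-cong (coeff-≈ p≋q 0) (*-congˡ (eval-cong (∷-injectiveʳ p≋q)))

    eval-addP : ∀ p q → eval (addP p q) x ≈ eval p x + eval q x
    eval-addP []      q       = sym (+-identityˡ _)
    eval-addP (a ∷ p) []      = sym (+-identityʳ _)
    eval-addP (a ∷ p) (b ∷ q) = trans (+-congˡ (*-congˡ (eval-addP p q)))
      (solve 5 (λ a b x u v → (a :+ b) :+ x :* (u :+ v) := (a :+ x :* u) :+ (b :+ x :* v)) refl a b x (eval p x) (eval q x))

    eval-scaleP : ∀ a p → eval (scaleP a p) x ≈ a * eval p x
    eval-scaleP a []      = sym (zeroʳ a)
    eval-scaleP a (b ∷ p) = trans (+-congˡ (*-congˡ (eval-scaleP a p)))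
      (solve 4 (λ a b x u → a :* b :+ x :* (a :* u) := a :* (b :+ x :* u)) refl a b x (eval p x))

    eval-addP-scaleP : ∀ p c q → eval (addP p (scaleP c q)) x ≈ eval p x + c * eval q x
    eval-addP-scaleP p c q = trans (eval-addP p (scaleP c q)) (+-congˡ (eval-scaleP c q))

    eval-mulP : ∀ p q → eval (mulP p q) x ≈ eval p x * eval q x
    eval-mulP []      q = sym (zeroˡ _)
    eval-mulP (a ∷ p) q = begin
      eval (addP (scaleP a q) (0# ∷ mulP p q)) x
        ≈⟨ eval-addP (scaleP a q) (0# ∷ mulP p q) ⟩
      eval (scaleP a q) x + (0# + x * eval (mulP p q) x)
        ≈⟨ +-cong (eval-scaleP a q) (trans (+-identityˡ _) (*-congˡ (eval-mulP p q))) ⟩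
      a * eval q x + x * (eval p x * eval q x)
        ≈⟨ solve 4 (λ a x u v → a :* v :+ x :* (u :* v) := (a :+ x :* u) :* v) refl a x (eval p x) (eval q x) ⟩
      (a + x * eval p x) * eval q x ∎
      where open SetoidReasoning setoid

module SumOfDerivatives {c ℓ : Level} (R : CommutativeRing c ℓ) (α : CommutativeRing.Carrier R) where
  open Poly R
  open CommutativeRing R hiding (zero)
  open Polynomials R
  open import Algebra.Properties.Semiring.Mult semiring
    using (×-congʳ; ×-congˡ; ×-homo-+; ×-assoc-*) renaming (_×_ to _·_)
  open NaturalCoefficientsSolver commutativeSemiring using (solve; _:=_; _:+_; _:*_; con)

  deriv-zP : deriv zP ≋ oneP
  deriv-zP = ∷-cong (+-identityʳ 1#) ≋-refl

  deriv-linP : deriv (linP α) ≋ oneP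
  deriv-linP = ∷-cong (+-identityʳ 1#) ≋-refl

  f-sucˡ : ∀ a b → f α (suc a) b ≋ mulP zP (f α a b)
  f-sucˡ a b = mulP-assoc zP (powP zP a) (powP (linP α) b)

  f-sucʳ : ∀ a b → f α a (suc b) ≋ mulP (linP α) (f α a b)
  f-sucʳ a b = mulP-swap (powP zP a) (linP α) (powP (linP α) b)

  deriv-f : ∀ a b → deriv (f α a b) ≋ addP (scaleP (a · 1#) (f α (a ∸ 1) b)) (scaleP (b · 1#) (f α a (b ∸ 1)))
  deriv-f a b = ≋-trans (leibniz zᵃ lᵇ) (addP-cong
    (≋-trans (mulP-congˡ lᵇ (deriv-powP deriv-zP a)) (mulP-scaleˡ (a · 1#) (powP zP (a ∸ 1)) lᵇ))
    (≋-trans (mulP-congʳ zᵃ (deriv-powP deriv-linP b)) (mulP-scaleʳ (b · 1#) zᵃ (powP (linP α) (b ∸ 1)))))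
    where
    zᵃ = powP zP a
    lᵇ = powP (linP α) b

  derivN-suc-f : ∀ n a b → derivN (suc n) (f α a b)
                 ≋ addP (scaleP (a · 1#) (derivN n (f α (a ∸ 1) b))) (scaleP (b · 1#) (derivN n (f α a (b ∸ 1))))
  derivN-suc-f n a b = begin
    derivN (suc n) (f α a b)   ≡⟨ derivN-suc n (f α a b) ⟩
    derivN n (deriv (f α a b)) ≈⟨ derivN-cong n (deriv-f a b) ⟩
    derivN n (addP (scaleP (a · 1#) (f α (a ∸ 1) b)) (scaleP (b · 1#) (f α a (b ∸ 1))))
      ≈⟨ derivN-addP n (scaleP (a · 1#) (f α (a ∸ 1) b)) (scaleP (b · 1#) (f α a (b ∸ 1))) ⟩
    addP (derivN n (scaleP (a · 1#) (f α (a ∸ 1) b))) (derivN n (scaleP (b · 1#) (f α a (b ∸ 1))))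
      ≈⟨ addP-cong (derivN-scaleP n (a · 1#) (f α (a ∸ 1) b)) (derivN-scaleP n (b · 1#) (f α a (b ∸ 1))) ⟩
    addP (scaleP (a · 1#) (derivN n (f α (a ∸ 1) b))) (scaleP (b · 1#) (derivN n (f α a (b ∸ 1)))) ∎
    where open SetoidReasoning ≋-setoid

  derivN-f-vanishes : ∀ a b → derivN (suc (a ℕ.+ b)) (f α a b) ≋ []
  derivN-f-vanishes a b = ≋-trans (derivN-suc-f (a ℕ.+ b) a b) (addP-cong (lowerˡ a b) (lowerʳ a b))
    where
    lowerˡ : ∀ a b → scaleP (a · 1#) (derivN (a ℕ.+ b) (f α (a ∸ 1) b)) ≋ []
    lowerˡ zero    b = scaleP-zeroˡ (derivN b (f α 0 b)) refl
    lowerˡ (suc a) b = scaleP-zeroʳ (suc a · 1#) (derivN-f-vanishes a b)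

    lowerʳ : ∀ a b → scaleP (b · 1#) (derivN (a ℕ.+ b) (f α a (b ∸ 1))) ≋ []
    lowerʳ a zero    = scaleP-zeroˡ (derivN (a ℕ.+ 0) (f α a 0)) refl
    lowerʳ a (suc b) = scaleP-zeroʳ (suc b · 1#)
      (≡.subst (λ n → derivN n (f α a b) ≋ []) (≡.sym (ℕ.+-suc a b)) (derivN-f-vanishes a b))

  zP≋linP+α : zP ≋ addP (linP α) (α ∷ [])
  zP≋linP+α = ∷-cong (sym (-‿inverseˡ α)) ≋-refl

  linP≋zP-α : linP α ≋ addP zP (- α ∷ [])
  linP≋zP-α = ∷-cong (sym (+-identityˡ (- α))) ≋-refl

  f-shiftʳ : ∀ a b → f α (suc a) (suc b) ≋ addP (f α a (suc (suc b))) (scaleP α (f α a (suc b)))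
  f-shiftʳ a b = begin
    f α (suc a) (suc b)                      ≈⟨ f-sucˡ a (suc b) ⟩
    mulP zP g                                ≈⟨ mulP-congˡ g zP≋linP+α ⟩
    mulP (addP (linP α) (α ∷ [])) g          ≈⟨ mulP-addP-const (linP α) α g ⟩
    addP (mulP (linP α) g) (scaleP α g)      ≈⟨ addP-congʳ (scaleP α g) (f-sucʳ a (suc b)) ⟨
    addP (f α a (suc (suc b))) (scaleP α g)  ∎
    where
    g = f α a (suc b)
    open SetoidReasoning ≋-setoid

  f-shiftˡ : ∀ a b → f α (suc a) (suc b) ≋ addP (f α (suc (suc a)) b) (scaleP (- α) (f α (suc a) b))
  f-shiftˡ a b = begin
    f α (suc a) (suc b)                        ≈⟨ f-sucʳ (suc a) b ⟩
    mulP (linP α) g                            ≈⟨ mulP-congˡ g linP≋zP-α ⟩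
    mulP (addP zP (- α ∷ [])) g                ≈⟨ mulP-addP-const zP (- α) g ⟩
    addP (mulP zP g) (scaleP (- α) g)          ≈⟨ addP-congʳ (scaleP (- α) g) (f-sucˡ (suc a) b) ⟨
    addP (f α (suc (suc a)) b) (scaleP (- α) g) ∎
    where
    g = f α (suc a) b
    open SetoidReasoning ≋-setoid

  P-sumDerivs : ∀ {m} a b → a ℕ.+ b ≤ m → sumDerivs m (f α a b) ≋ P α a b
  P-sumDerivs a b a+b≤m = sumDerivs-stable (f α a b) (derivN-f-vanishes a b) a+b≤m

  P-suc-suc : ∀ a b → P α (suc a) (suc b)
              ≋ addP (f α (suc a) (suc b)) (addP (scaleP (suc a · 1#) (P α a (suc b))) (scaleP (suc b · 1#) (P α (suc a) b)))
  P-suc-suc a b = begin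
    sumDerivs (suc m) (f α (suc a) (suc b))
      ≈⟨ sumDerivs-suc m (f α (suc a) (suc b)) ⟩
    addP (f α (suc a) (suc b)) (sumDerivs m (deriv (f α (suc a) (suc b))))
      ≈⟨ addP-congˡ (f α (suc a) (suc b)) (sumDerivs-cong m (deriv-f (suc a) (suc b))) ⟩
    addP (f α (suc a) (suc b)) (sumDerivs m (addP (scaleP s (f α a (suc b))) (scaleP t (f α (suc a) b))))
      ≈⟨ addP-congˡ (f α (suc a) (suc b)) (≋-trans (sumDerivs-addP m (scaleP s (f α a (suc b))) (scaleP t (f α (suc a) b)))
           (addP-cong (sumDerivs-scaleP m s (f α a (suc b))) (sumDerivs-scaleP m t (f α (suc a) b)))) ⟩
    addP (f α (suc a) (suc b)) (addP (scaleP s (P α a (suc b))) (scaleP t (sumDerivs m (f α (suc a) b))))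
      ≈⟨ addP-congˡ (f α (suc a) (suc b)) (addP-congˡ (scaleP s (P α a (suc b)))
           (scaleP-cong refl (P-sumDerivs (suc a) b (ℕ.≤-reflexive (≡.sym (ℕ.+-suc a b)))))) ⟩
    addP (f α (suc a) (suc b)) (addP (scaleP s (P α a (suc b))) (scaleP t (P α (suc a) b))) ∎
    where
    m = a ℕ.+ suc b
    s = suc a · 1#
    t = suc b · 1#
    open SetoidReasoning ≋-setoid

  P-shiftʳ : ∀ a b → P α (suc a) (suc b) ≋ addP (P α a (suc (suc b))) (scaleP α (P α a (suc b)))
  P-shiftʳ a b = begin
    sumDerivs m (f α (suc a) (suc b))
      ≈⟨ sumDerivs-cong m (f-shiftʳ a b) ⟩
    sumDerivs m (addP (f α a (suc (suc b))) (scaleP α (f α a (suc b))))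
      ≈⟨ sumDerivs-addP-scaleP m (f α a (suc (suc b))) α (f α a (suc b)) ⟩
    addP (sumDerivs m (f α a (suc (suc b)))) (scaleP α (sumDerivs m (f α a (suc b))))
      ≈⟨ addP-cong (P-sumDerivs a (suc (suc b)) (ℕ.≤-reflexive (ℕ.+-suc a (suc b))))
                   (scaleP-cong refl (P-sumDerivs a (suc b) (ℕ.n≤1+n (a ℕ.+ suc b)))) ⟩
    addP (P α a (suc (suc b))) (scaleP α (P α a (suc b))) ∎
    where
    m = suc a ℕ.+ suc b
    open SetoidReasoning ≋-setoid

  P-shiftˡ : ∀ a b → P α (suc a) (suc b) ≋ addP (P α (suc (suc a)) b) (scaleP (- α) (P α (suc a) b))
  P-shiftˡ a b = begin
    sumDerivs m (f α (suc a) (suc b))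
      ≈⟨ sumDerivs-cong m (f-shiftˡ a b) ⟩
    sumDerivs m (addP (f α (suc (suc a)) b) (scaleP (- α) (f α (suc a) b)))
      ≈⟨ sumDerivs-addP-scaleP m (f α (suc (suc a)) b) (- α) (f α (suc a) b) ⟩
    addP (sumDerivs m (f α (suc (suc a)) b)) (scaleP (- α) (sumDerivs m (f α (suc a) b)))
      ≈⟨ addP-cong (P-sumDerivs (suc (suc a)) b (ℕ.≤-reflexive m≡))
                   (scaleP-cong refl (P-sumDerivs (suc a) b (ℕ.≤-trans (ℕ.n≤1+n (suc a ℕ.+ b)) (ℕ.≤-reflexive m≡)))) ⟩
    addP (P α (suc (suc a)) b) (scaleP (- α) (P α (suc a) b)) ∎
    where
    m = suc a ℕ.+ suc b
    m≡ : suc (suc a) ℕ.+ b ≡.≡ m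
    m≡ = ≡.cong suc (≡.sym (ℕ.+-suc a b))
    open SetoidReasoning ≋-setoid

  τ : ℕ → Carrier
  τ i = (2 ℕ.* i ∸ 1) · 1#

  τ-suc-suc : ∀ m → τ (suc (suc m)) ≈ 1# + (suc m · 1# + suc m · 1#)
  τ-suc-suc m = trans (×-congˡ 2i-1≡) (+-congˡ (×-homo-+ 1# (suc m) (suc m)))
    where
    2i-1≡ : 2 ℕ.* suc (suc m) ∸ 1 ≡.≡ suc (suc m ℕ.+ suc m)
    2i-1≡ = ≡.cong suc (≡.trans (ℕ.+-suc m (suc (m ℕ.+ 0))) (≡.cong (λ k → suc (m ℕ.+ suc k)) (ℕ.+-identityʳ m)))

  ×-as-* : ∀ n y → (n · 1#) * y ≈ n · y
  ×-as-* n y = trans (×-assoc-* n 1# y) (×-congʳ n (*-identityˡ y))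

  transpose-summand : ∀ {e w c c′ u} → e ≈ w + c * u → c + c′ ≈ 0# → w ≈ e + c′ * u
  transpose-summand {e} {w} {c} {c′} {u} e≈ c+c′≈0 = begin
    w                        ≈⟨ +-identityʳ w ⟨
    w + 0#                   ≈⟨ +-congˡ (trans (*-congʳ c+c′≈0) (zeroˡ u)) ⟨
    w + (c + c′) * u         ≈⟨ solve 4 (λ w c c′ u → w :+ (c :+ c′) :* u := (w :+ c :* u) :+ c′ :* u) refl w c c′ u ⟩
    (w + c * u) + c′ * u     ≈⟨ +-congʳ e≈ ⟨
    e + c′ * u               ∎
    where open SetoidReasoning setoid

  module AtCommonRoot (x : Carrier) (root : ∀ a b → eval (f α (suc a) (suc b)) x ≈ 0#) where
    Pₓ : ℕ → ℕ → Carrier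
    Pₓ a b = eval (P α a b) x

    Pₓ-suc-suc : ∀ a b → Pₓ (suc a) (suc b) ≈ (suc a · 1#) * Pₓ a (suc b) + (suc b · 1#) * Pₓ (suc a) b
    Pₓ-suc-suc a b = begin
      Pₓ (suc a) (suc b)
        ≈⟨ eval-cong x (P-suc-suc a b) ⟩
      eval (addP (f α (suc a) (suc b)) (addP (scaleP s (P α a (suc b))) (scaleP t (P α (suc a) b)))) x
        ≈⟨ eval-addP x (f α (suc a) (suc b)) (addP (scaleP s (P α a (suc b))) (scaleP t (P α (suc a) b))) ⟩
      eval (f α (suc a) (suc b)) x + eval (addP (scaleP s (P α a (suc b))) (scaleP t (P α (suc a) b))) x
        ≈⟨ +-cong (root a b) (eval-addP x (scaleP s (P α a (suc b))) (scaleP t (P α (suc a) b))) ⟩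
      0# + (eval (scaleP s (P α a (suc b))) x + eval (scaleP t (P α (suc a) b)) x)
        ≈⟨ trans (+-identityˡ _) (+-cong (eval-scaleP x s (P α a (suc b))) (eval-scaleP x t (P α (suc a) b))) ⟩
      s * Pₓ a (suc b) + t * Pₓ (suc a) b ∎
      where
      s = suc a · 1#
      t = suc b · 1#
      open SetoidReasoning setoid

    Pₓ-shiftʳ : ∀ a b → Pₓ (suc a) (suc b) ≈ Pₓ a (suc (suc b)) + α * Pₓ a (suc b)
    Pₓ-shiftʳ a b = trans (eval-cong x (P-shiftʳ a b)) (eval-addP-scaleP x (P α a (suc (suc b))) α (P α a (suc b)))

    Pₓ-shiftˡ : ∀ a b → Pₓ (suc a) (suc b) ≈ Pₓ (suc (suc a)) b + (- α) * Pₓ (suc a) b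
    Pₓ-shiftˡ a b = trans (eval-cong x (P-shiftˡ a b)) (eval-addP-scaleP x (P α (suc (suc a)) b) (- α) (P α (suc a) b))

    column-step : ∀ m →
      (Pₓ (suc m) (suc (suc m)) ≈ suc m · ((τ (suc (suc m)) - α) * Pₓ m (suc m) + τ (suc (suc m)) * Pₓ (suc m) m)) ×
      (Pₓ (suc (suc m)) (suc m) ≈ suc m · (τ (suc (suc m)) * Pₓ m (suc m) + (τ (suc (suc m)) + α) * Pₓ (suc m) m))
    column-step m = upper , lower
      where
      N = suc m · 1#
      t = τ (suc (suc m))
      T = 1# + (N + N)
      U = Pₓ m (suc m)
      V = Pₓ (suc m) m
      E = Pₓ (suc m) (suc m)
      E≈ : E ≈ N * U + N * V
      E≈ = Pₓ-suc-suc m m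
      τ≈ : t ≈ T
      τ≈ = τ-suc-suc m
      open SetoidReasoning setoid
      upper : Pₓ (suc m) (suc (suc m)) ≈ suc m · ((t - α) * U + t * V)
      upper = begin
        Pₓ (suc m) (suc (suc m))
          ≈⟨ Pₓ-suc-suc m (suc m) ⟩
        N * Pₓ m (suc (suc m)) + (1# + N) * E
          ≈⟨ +-congʳ (*-congˡ (transpose-summand (Pₓ-shiftʳ m m) (-‿inverseʳ α))) ⟩
        N * (E + (- α) * U) + (1# + N) * E
          ≈⟨ +-cong (*-congˡ (+-congʳ E≈)) (*-congˡ E≈) ⟩
        N * ((N * U + N * V) + (- α) * U) + (1# + N) * (N * U + N * V)
          ≈⟨ solve 4 (λ N a U V → N :* ((N :* U :+ N :* V) :+ a :* U) :+ (con 1 :+ N) :* (N :* U :+ N :* V)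
                     := N :* (((con 1 :+ (N :+ N)) :+ a) :* U :+ (con 1 :+ (N :+ N)) :* V)) refl N (- α) U V ⟩
        N * ((T + - α) * U + T * V)
          ≈⟨ *-congˡ (+-cong (*-congʳ (+-congʳ τ≈)) (*-congʳ τ≈)) ⟨
        N * ((t - α) * U + t * V)
          ≈⟨ ×-as-* (suc m) _ ⟩
        suc m · ((t - α) * U + t * V) ∎
      lower : Pₓ (suc (suc m)) (suc m) ≈ suc m · (t * U + (t + α) * V)
      lower = begin
        Pₓ (suc (suc m)) (suc m)
          ≈⟨ Pₓ-suc-suc (suc m) m ⟩
        (1# + N) * E + N * Pₓ (suc (suc m)) m
          ≈⟨ +-congˡ (*-congˡ (transpose-summand (Pₓ-shiftˡ m m) (-‿inverseˡ α))) ⟩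
        (1# + N) * E + N * (E + α * V)
          ≈⟨ +-cong (*-congˡ E≈) (*-congˡ (+-congʳ E≈)) ⟩
        (1# + N) * (N * U + N * V) + N * ((N * U + N * V) + α * V)
          ≈⟨ solve 4 (λ N a U V → (con 1 :+ N) :* (N :* U :+ N :* V) :+ N :* ((N :* U :+ N :* V) :+ a :* V)
                     := N :* ((con 1 :+ (N :+ N)) :* U :+ ((con 1 :+ (N :+ N)) :+ a) :* V)) refl N α U V ⟩
        N * (T * U + (T + α) * V)
          ≈⟨ *-congˡ (+-cong (*-congʳ τ≈) (*-congʳ (+-congʳ τ≈))) ⟨
        N * (t * U + (t + α) * V)
          ≈⟨ ×-as-* (suc m) _ ⟩
        suc m · (t * U + (t + α) * V) ∎

module Matrices {c ℓ : Level} (R : CommutativeRing c ℓ) where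
  open Poly R
  open CommutativeRing R hiding (zero)
  open import Algebra.Properties.Semiring.Mult semiring
    using (×-congʳ; ×-homo-1; ×-assocˡ; ×-comm-*) renaming (_×_ to _·_)
  open import Algebra.Properties.CommutativeMonoid.Mult +-commutativeMonoid using (×-distrib-+)

  ≈M-setoid : Setoid c ℓ
  ≈M-setoid = record
    { Carrier       = Mat2
    ; _≈_           = _≈M_
    ; isEquivalence = record
      { refl  = λ i j → refl
      ; sym   = λ A≈B i j → sym (A≈B i j)
      ; trans = λ A≈B B≈C i j → trans (A≈B i j) (B≈C i j)
      }
    }

  *M-congˡ : ∀ M {N N′} → N ≈M N′ → (M *M N) ≈M (M *M N′)
  *M-congˡ M N≈N′ i j = +-cong (*-congˡ (N≈N′ zero j)) (*-congˡ (N≈N′ (suc zero) j))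

  ·M-congʳ : ∀ k {M N} → M ≈M N → (k ·M M) ≈M (k ·M N)
  ·M-congʳ k M≈N i j = ×-congʳ k (M≈N i j)

  *M-identityʳ : ∀ M → (M *M idM) ≈M M
  *M-identityʳ M i zero       = trans (+-cong (*-identityʳ _) (zeroʳ _)) (+-identityʳ _)
  *M-identityʳ M i (suc zero) = trans (+-cong (zeroʳ _) (*-identityʳ _)) (+-identityˡ _)

  ·M-identityˡ : ∀ M → (1 ·M M) ≈M M
  ·M-identityˡ M i j = ×-homo-1 (M i j)

  ·M-assoc : ∀ m n M → (m ·M n ·M M) ≈M ((m ℕ.* n) ·M M)
  ·M-assoc m n M i j = ×-assocˡ (M i j) m n

  *M-·M : ∀ M k N → (M *M (k ·M N)) ≈M (k ·M M *M N)
  *M-·M M k N i j =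
    trans (+-cong (×-comm-* k (M i zero) (N zero j)) (×-comm-* k (M i (suc zero)) (N (suc zero) j)))
          (sym (×-distrib-+ _ _ k))

  scaled-prodC : ∀ α (M : ℕ → Mat2) → M 1 ≈M C α 1 →
                 (∀ m → M (suc (suc m)) ≈M (suc m ·M C α (suc (suc m)) *M M (suc m))) →
                 ∀ m → M (suc m) ≈M ((m !) ·M prodC α (suc m))
  scaled-prodC α M base step zero = begin
    M 1                       ≈⟨ base ⟩
    C α 1                     ≈⟨ *M-identityʳ (C α 1) ⟨
    C α 1 *M idM              ≈⟨ ·M-identityˡ (C α 1 *M idM) ⟨
    1 ·M (C α 1 *M idM)       ∎
    where open SetoidReasoning ≈M-setoid
  scaled-prodC α M base step (suc m) = begin
    M (suc (suc m))                                     ≈⟨ step m ⟩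
    suc m ·M (Cₘ *M M (suc m))                          ≈⟨ ·M-congʳ (suc m) (*M-congˡ Cₘ (scaled-prodC α M base step m)) ⟩
    suc m ·M (Cₘ *M ((m !) ·M prodC α (suc m)))         ≈⟨ ·M-congʳ (suc m) (*M-·M Cₘ (m !) (prodC α (suc m))) ⟩
    suc m ·M ((m !) ·M (Cₘ *M prodC α (suc m)))         ≈⟨ ·M-assoc (suc m) (m !) (Cₘ *M prodC α (suc m)) ⟩
    (suc m !) ·M prodC α (suc (suc m))                  ∎
    where
    Cₘ = C α (suc (suc m))
    open SetoidReasoning ≈M-setoid

module MatrixFactorisation {c ℓ : Level} (R : CommutativeRing c ℓ) (α : CommutativeRing.Carrier R) where
  open Poly R
  open CommutativeRing R hiding (zero)
  open Polynomials R
  open SumOfDerivatives R α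
  open Matrices R
  open NaturalCoefficientsSolver commutativeSemiring using (solve; _:=_; _:+_; _:*_; con)

  root-0 : ∀ a b → eval (f α (suc a) b) 0# ≈ 0#
  root-0 a b = trans (eval-cong 0# (f-sucˡ a b))
    (trans (eval-mulP 0# zP (f α a b)) (trans (*-congʳ (trans (+-identityˡ _) (zeroˡ _))) (zeroˡ _)))

  root-α : ∀ a b → eval (f α a (suc b)) α ≈ 0#
  root-α a b = trans (eval-cong α (f-sucʳ a b))
    (trans (eval-mulP α (linP α) (f α a b)) (trans (*-congʳ linP-α) (zeroˡ _)))
    where
    linP-α : eval (linP α) α ≈ 0#
    linP-α = trans (+-congˡ (trans (*-congˡ (trans (+-congˡ (zeroʳ α)) (+-identityʳ 1#))) (*-identityʳ α))) (-‿inverseˡ α)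

  module At0 = AtCommonRoot 0# (λ a b → root-0 a (suc b))
  module Atα = AtCommonRoot α (λ a b → root-α (suc a) b)

  A-suc-suc : ∀ m → A α (suc (suc m)) ≈M (suc m ·M C α (suc (suc m)) *M A α (suc m))
  A-suc-suc m zero       zero       = proj₁ (At0.column-step m)
  A-suc-suc m zero       (suc zero) = proj₁ (Atα.column-step m)
  A-suc-suc m (suc zero) zero       = proj₂ (At0.column-step m)
  A-suc-suc m (suc zero) (suc zero) = proj₂ (Atα.column-step m)

  P-0-1 : P α 0 1 ≋ addP (linP α) oneP
  P-0-1 = addP-cong f-0-1 (≋-trans (deriv-cong f-0-1) deriv-linP)
    where
    f-0-1 : f α 0 1 ≋ linP α
    f-0-1 = ≋-trans (f-sucʳ 0 0) (≋-trans (mulP-congʳ (linP α) (mulP-identityˡ oneP)) (mulP-identityʳ (linP α)))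

  P-1-0 : P α 1 0 ≋ addP zP oneP
  P-1-0 = addP-cong f-1-0 (≋-trans (deriv-cong f-1-0) deriv-zP)
    where
    f-1-0 : f α 1 0 ≋ zP
    f-1-0 = ≋-trans (f-sucˡ 0 0) (≋-trans (mulP-congʳ zP (mulP-identityˡ oneP)) (mulP-identityʳ zP))

  A-one : A α 1 ≈M C α 1
  A-one zero zero = trans (eval-cong 0# P-0-1) (trans (eval-addP 0# (linP α) oneP)
    (solve 1 (λ a → (a :+ con 0 :* (con 1 :+ con 0 :* con 0)) :+ (con 1 :+ con 0 :* con 0) := (con 1 :+ con 0) :+ a) refl (- α)))
  A-one zero (suc zero) = trans (eval-cong α P-0-1) (trans (eval-addP α (linP α) oneP)
    (trans (solve 2 (λ a x → (a :+ x :* (con 1 :+ x :* con 0)) :+ (con 1 :+ x :* con 0) := (a :+ x) :+ con 1) refl (- α) α)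
      (trans (+-congʳ (-‿inverseˡ α)) (+-comm 0# 1#))))
  A-one (suc zero) zero = trans (eval-cong 0# P-1-0) (trans (eval-addP 0# zP oneP)
    (solve 0 ((con 0 :+ con 0 :* (con 1 :+ con 0 :* con 0)) :+ (con 1 :+ con 0 :* con 0) := con 1 :+ con 0) refl))
  A-one (suc zero) (suc zero) = trans (eval-cong α P-1-0) (trans (eval-addP α zP oneP)
    (solve 1 (λ x → (con 0 :+ x :* (con 1 :+ x :* con 0)) :+ (con 1 :+ x :* con 0) := (con 1 :+ con 0) :+ x) refl α))

  A≈scaled-prodC : ∀ m → A α (suc m) ≈M ((m !) ·M prodC α (suc m))
  A≈scaled-prodC = scaled-prodC α (A α) A-one A-suc-suc

corollaryA3 : {c ℓ : Level} (K : CommutativeRing c ℓ) →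
    Poly.IsFieldR K → Poly.CharZero K →
    (α : CommutativeRing.Carrier K) → ¬ (CommutativeRing._≈_ K α (CommutativeRing.0# K)) →
    (n : ℕ) → n ≥ 1 →
    Poly._≈M_ K (Poly.A K α n) (Poly._·M_ K ((n ∸ 1) !) (Poly.prodC K α n))
corollaryA3 K _ _ α _ (suc m) _ = MatrixFactorisation.A≈scaled-prodC K α m
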